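{- Let $\mathcal{P}$ be a Wait-Only protocol and $\rho$ a finite or infinite execution of $\mathcal{P}$. Suppose there exist processes $e_1,e_2\in[1,\mathrm{nb}(\rho)]$ and an index $0\le j<|\rho|$ such that (i) $\rho_j(e_1)=\rho_j(e_2)\in Q_W$, (ii) $\mathrm{next}(\rho,j,e_1)=(q,j_1)$, and (iii) $\mathrm{next}(\rho,j,e_2)=(q,j_2)$ with $j_1\le j_2<|\rho|$. Then there exists an execution $\rho'$ of the form $\rho_0\cdots\rho_j\,\rho'_{j+1}\cdots\rho'_{j_2}\,\rho_{j_2+1}\rho_{j_2+2}\cdots$ such that $\rho'_k(e_1)=\rho'_k(e_2)=\rho_k(e_1)$ for all $j+1\le k\le j_1$, and $\rho'_k(e_1)=\rho_k(e_1)$ and $\rho'_k(e_2)=q$ for all $j_1<k\le j_2$. In particular $\mathrm{next}(\rho',j,e_1)=\mathrm{next}(\rho',j,e_2)=(q,j_1)$.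
   Context: A protocol is $\mathcal{P}=(Q,\Sigma,q_{in},T)$ with finite state set $Q$, finite message set $\Sigma$, initial state $q_{in}$, and $T\subseteq Q\times(\{!!a\}_{a\in\Sigma}\cup\{?a\}_{a\in\Sigma})\times Q$ ($!!a$ broadcast, $?a$ reception); $R(q)=\{a\mid\exists q',(q,?a,q')\in T\}$. It is Wait-Only if no state has both an outgoing reception and an outgoing broadcast; $Q_W$ (waiting states) are states with an outgoing reception, $Q_A=Q\setminus Q_W$ (action states), and $q_{in}\in Q_A$. Configurations are vectors $C\in Q^n$ ($n\ge1$), initial if all entries are $q_{in}$. $C\xrightarrow{e,t}C'$ for $t=(q,!!a,q')\in T$ means $C(e)=q$, $C'(e)=q'$, and every $e'\ne e$ either has $(C(e'),?a,C'(e'))\in T$, or $a\notin R(C(e'))$ and $C'(e')=C(e')$; $C\rightarrow C'$ if this holds for some $e,t$. A finite (resp. infinite) execution is a sequence $\rho=\rho_0\rho_1\cdots\rho_\ell$ (resp. $\rho_0\rho_1\cdots$) of configurations with $\rho_0$ initial and $\rho_{i-1}\rightarrow\rho_i$ for all $i\ge1$; its length $|\rho|$ is $\ell+1$ (resp. $\omega$), and $\mathrm{nb}(\rho)$ is the number of processes. Fix a state $q_u\in Q$, $q_u\ne q_{in}$, occurring in no transition. For $\rho_j(e)\in Q_W$, let $\mathrm{nextIdx}(\rho,j,e)=\min\{k\mid j\le k\le|\rho|,\ k=|\rho|\text{ or }\rho_k(e)\in Q_A\}$ (equal to $|\rho|$ if $e$ never reaches an action state after $j$), let $\mathrm{nextState}(\rho,j,e)=\rho_{\mathrm{nextIdx}(\rho,j,e)}(e)$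 if $\mathrm{nextIdx}(\rho,j,e)\ne|\rho|$ and $q_u$ otherwise, and $\mathrm{next}(\rho,j,e)=(\mathrm{nextState}(\rho,j,e),\mathrm{nextIdx}(\rho,j,e))$. -}

module Defs where

open import Data.Nat using (ℕ; zero; suc; _≤_; _<_)
open import Data.Fin using (Fin)
open import Data.List using (List)
open import Data.List.Membership.Propositional using (_∈_)
open import Data.Product using (_×_; _,_; ∃; ∃-syntax)
open import Data.Sum using (_⊎_)
open import Data.Unit using (⊤)
open import Data.Maybe using (Maybe; just; nothing)
open import Relation.Nullary using (¬_)
open import Relation.Binary.PropositionalEquality using (_≡_; _≢_)

data Label (nΣ : ℕ) : Set where
  bcast : Fin nΣ → Label nΣ
  recv  : Fin nΣ → Label nΣ

record Protocol : Set where
  field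
    nQ  : ℕ
    nΣ  : ℕ
    qin : Fin nQ
    T   : List (Fin nQ × Label nΣ × Fin nQ)

module _ (P : Protocol) where
  open Protocol P

  State : Set
  State = Fin nQ

  Msg : Set
  Msg = Fin nΣ

  _∈R_ : Msg → State → Set
  a ∈R q = ∃[ q' ] ((q , recv a , q') ∈ T)

  QW : State → Set
  QW q = ∃[ a ] (a ∈R q)

  QA : State → Set
  QA q = ¬ QW q

  HasBroadcast : State → Set
  HasBroadcast q = ∃[ b ] ∃[ q' ] ((q , bcast b , q') ∈ T)

  WaitOnly : Set
  WaitOnly = (∀ q → ¬ (QW q × HasBroadcast q)) × QA qin

  Config : ℕ → Set
  Config n = Fin n → State

  Initial : ∀ {n} → Config n → Set
  Initial C = ∀ e → C e ≡ qin

  StepWith : ∀ {n} → Config n → Fin n → State → Msg → State → Config n → Set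
  StepWith {n} C e q a q' C' =
    ((q , bcast a , q') ∈ T) × C e ≡ q × C' e ≡ q' ×
    (∀ (e' : Fin n) → e' ≢ e →
       ((C e' , recv a , C' e') ∈ T) ⊎ ((¬ (a ∈R C e')) × C' e' ≡ C e'))

  _⟶_ : ∀ {n} → Config n → Config n → Set
  C ⟶ C' = ∃[ e ] ∃[ q ] ∃[ a ] ∃[ q' ] StepWith C e q a q' C'

-- lengths of executions: finite (ℓ + 1) or ω
data Len : Set where
  fin : ℕ → Len
  ω   : Len

_<ᴸ_ : ℕ → Len → Set
k <ᴸ fin m = k < m
k <ᴸ ω     = ⊤

-- A finite or infinite execution with n processes.  The configuration
-- sequence is a function ℕ → Config; only indices k < |ρ| are meaningful.
record Execution (P : Protocol) (n : ℕ) : Set where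
  field
    len     : Len
    len-pos : 0 <ᴸ len
    conf    : ℕ → Config P n
    initial : Initial P (conf 0)
    steps   : ∀ i → suc i <ᴸ len → _⟶_ P (conf i) (conf (suc i))

open Execution public

-- next(ρ, j, e) = (s , k), as a (functional) relation; the state q_u
-- is rendered as `nothing`, actual states q as `just q`.
-- nextIdx is the least k with j ≤ k ≤ |ρ| such that k = |ρ| or ρ_k(e) ∈ Q_A.
data Next {P : Protocol} {n : ℕ} (ρ : Execution P n) (j : ℕ) (e : Fin n)
       : Maybe (State P) → Len → Set where
  found    : ∀ k → j ≤ k → k <ᴸ len ρ → QA P (conf ρ k e) →
             (∀ m → j ≤ m → m < k → QW P (conf ρ m e)) →
             Next ρ j e (just (conf ρ k e)) (fin k)
  notFound : (∀ m → j ≤ m → m <ᴸ len ρ → QW P (conf ρ m e)) →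
             Next ρ j e nothing (len ρ)

{-# OPTIONS --safe #-}
-- Only e₂ is changed.  Its new trajectory is its own up to j, that of e₁ on
-- [j, j₁], the state q on [j₁, j₂], and its own again from j₂; the pieces agree
-- at the seams because ρ_j(e₁) = ρ_j(e₂), ρ_{j₁}(e₁) = q = ρ_{j₂}(e₂).  Every
-- step of ρ between j and j₂ is broadcast by a process other than e₁ and e₂
-- (both wait there, and in a Wait-Only protocol waiting states cannot
-- broadcast), so e₂ can copy e₁'s reception before j₁, and afterwards it
-- ignores every message since q is an action state and has no receptions.
module Submission where

open import Defs
open import Data.Nat using (ℕ; suc; _≤_; _<_; z≤n)
open import Data.Nat.Properties
  using (_≤?_; ≤-refl; ≤-trans; <-≤-trans; <⇒≤; <⇒≱; ≰⇒>; ≮⇒≥; ≤∧≢⇒<; m≤n⇒m<n∨m≡n; m≤n⇒m≤1+n; ≤-total)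
open import Data.Fin using (Fin; _≟_)
open import Data.Vec.Functional using (updateAt)
open import Data.Vec.Functional.Properties using (updateAt-updates; updateAt-minimal; updateAt-id-local)
open import Data.Product using (_×_; Σ-syntax; _,_)
open import Data.Sum using (_⊎_; inj₁; inj₂)
open import Data.Maybe using (just)
open import Data.List.Membership.Propositional using (_∈_)
open import Function using (const)
open import Relation.Nullary using (¬_; yes; no; contradiction)
open import Relation.Binary.PropositionalEquality
  using (_≡_; _≢_; _≗_; refl; sym; trans; subst; subst₂)

Reacts : (P : Protocol) → Msg P → State P → State P → Set
Reacts P a s s′ = ((s , recv a , s′) ∈ Protocol.T P) ⊎ ((¬ _∈R_ P a s) × s′ ≡ s)

module _ {P : Protocol} where

  action-state-ignores : ∀ {a s} → QA P s → Reacts P a s s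
  action-state-ignores {a} action = inj₂ ((λ a∈R → action (a , a∈R)) , refl)

  waiting-cannot-broadcast : ∀ {n} {C D : Config P n} {e s a s′} →
    WaitOnly P → StepWith P C e s a s′ D → ¬ QW P (C e)
  waiting-cannot-broadcast {C = C} {e = e} (no-mixed , _) (t , refl , _ , _) waiting =
    no-mixed (C e) (waiting , _ , _ , t)

  ⟶-resp-≗ : ∀ {n} {C C′ D D′ : Config P n} → C ≗ C′ → D ≗ D′ → _⟶_ P C D → _⟶_ P C′ D′
  ⟶-resp-≗ C≗C′ D≗D′ (e , s , a , s′ , t , Ce , De , reacts) =
    e , s , a , s′ , t , trans (sym (C≗C′ e)) Ce , trans (sym (D≗D′ e)) De ,
    λ e′ e′≢e → subst₂ (Reacts P a) (C≗C′ e′) (D≗D′ e′) (reacts e′ e′≢e)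

  ⟶-updateAt : ∀ {n} {C D : Config P n} {e x s a s′ r r′} →
    StepWith P C e s a s′ D → e ≢ x → Reacts P a r r′ →
    _⟶_ P (updateAt C x (const r)) (updateAt D x (const r′))
  ⟶-updateAt {C = C} {D} {e} {x} {s} {a} {s′} {r} {r′} (t , Ce , De , reacts) e≢x x-reacts =
    e , s , a , s′ , t , trans (updateAt-minimal e x C e≢x) Ce , trans (updateAt-minimal e x D e≢x) De ,
    reacts′
    where
    reacts′ : ∀ e′ → e′ ≢ e → Reacts P a (updateAt C x (const r) e′) (updateAt D x (const r′) e′)
    reacts′ e′ e′≢e with e′ ≟ x
    ... | yes refl = subst₂ (Reacts P a) (sym (updateAt-updates x C)) (sym (updateAt-updates x D)) x-reacts
    ... | no e′≢x  = subst₂ (Reacts P a) (sym (updateAt-minimal e′ x C e′≢x))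
                       (sym (updateAt-minimal e′ x D e′≢x)) (reacts e′ e′≢e)

module _ {a} {A : Set a} where

  splice : ℕ → (ℕ → A) → (ℕ → A) → ℕ → A
  splice t f g k with k ≤? t
  ... | yes _ = f k
  ... | no _  = g k

  splice-≤ : ∀ {t k} {f g : ℕ → A} → k ≤ t → splice t f g k ≡ f k
  splice-≤ {t} {k} k≤t with k ≤? t
  ... | yes _  = refl
  ... | no k≰t = contradiction k≤t k≰t

  splice-> : ∀ {t k} {f g : ℕ → A} → t < k → splice t f g k ≡ g k
  splice-> {t} {k} t<k with k ≤? t
  ... | yes k≤t = contradiction k≤t (<⇒≱ t<k)
  ... | no _    = refl

  splice-≥ : ∀ {t k} {f g : ℕ → A} → f t ≡ g t → t ≤ k → splice t f g k ≡ g k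
  splice-≥ {t} {f = f} {g} seam t≤k with m≤n⇒m<n∨m≡n t≤k
  ... | inj₁ t<k  = splice-> t<k
  ... | inj₂ refl = trans (splice-≤ {t} {t} {f} {g} ≤-refl) seam

Next-resp : ∀ {P n n′} {ρ : Execution P n} {ρ′ : Execution P n′} {j k e e′ q} →
  len ρ′ ≡ len ρ → (∀ m → j ≤ m → m ≤ k → conf ρ′ m e′ ≡ conf ρ m e) →
  Next ρ j e (just q) (fin k) → Next ρ′ j e′ (just q) (fin k)
Next-resp {P} {ρ′ = ρ′} {j} {e′ = e′} same-len agree (found k j≤k k<len action waiting) =
  subst (λ s → Next ρ′ j e′ (just s) (fin k)) (agree k j≤k ≤-refl)
    (found k j≤k (subst (k <ᴸ_) (sym same-len) k<len)
      (subst (QA P) (sym (agree k j≤k ≤-refl)) action)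
      (λ m j≤m m<k → subst (QW P) (sym (agree m j≤m (<⇒≤ m<k))) (waiting m j≤m m<k)))

record FirstAction {P n} (ρ : Execution P n) (j : ℕ) (e : Fin n) (q : State P) (k : ℕ) : Set where
  field
    start≤  : j ≤ k
    reached : conf ρ k e ≡ q
    action  : QA P q
    waiting : ∀ m → j ≤ m → m < k → QW P (conf ρ m e)

module _ {P n} {ρ : Execution P n} {j : ℕ} {e : Fin n} {q : State P} {k : ℕ} where
  open FirstAction

  Next⇒FirstAction : Next ρ j e (just q) (fin k) → FirstAction ρ j e q k
  Next⇒FirstAction (found k j≤k _ action waiting) = record
    { start≤ = j≤k ; reached = refl ; action = action ; waiting = waiting }

  FirstAction-start< : FirstAction ρ j e q k → QW P (conf ρ j e) → j < k
  FirstAction-start< A waiting-at-j =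
    ≤∧≢⇒< (start≤ A) λ { refl → action A (subst (QW P) (reached A) waiting-at-j) }

  FirstAction-minimal : ∀ {m} → FirstAction ρ j e q k → j ≤ m → QA P (conf ρ m e) → k ≤ m
  FirstAction-minimal A j≤m action-at-m = ≮⇒≥ λ m<k → action-at-m (waiting A _ j≤m m<k)

module Redirect (P : Protocol) (wait-only : WaitOnly P) {n : ℕ} (ρ : Execution P n)
  (e₁ e₂ : Fin n) (j j₁ j₂ : ℕ) (q : State P)
  (same-at-j : conf ρ j e₁ ≡ conf ρ j e₂) (waiting-at-j : QW P (conf ρ j e₁))
  (A₁ : FirstAction ρ j e₁ q j₁) (A₂ : FirstAction ρ j e₂ q j₂) (j₁≤j₂ : j₁ ≤ j₂) where

  open FirstAction

  j<j₁ : j < j₁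
  j<j₁ = FirstAction-start< A₁ waiting-at-j

  parked : ℕ → State P
  parked = splice j₂ (const q) (λ k → conf ρ k e₂)

  copying : ℕ → State P
  copying = splice j₁ (λ k → conf ρ k e₁) parked

  trajectory : ℕ → State P
  trajectory = splice j (λ k → conf ρ k e₂) copying

  trajectory-before : ∀ {k} → k ≤ j → trajectory k ≡ conf ρ k e₂
  trajectory-before = splice-≤

  trajectory-copies : ∀ {k} → j ≤ k → k ≤ j₁ → trajectory k ≡ conf ρ k e₁
  trajectory-copies j≤k k≤j₁ = trans (splice-≥ seam j≤k) (splice-≤ k≤j₁)
    where
    seam : conf ρ j e₂ ≡ copying j
    seam = trans (sym same-at-j) (sym (splice-≤ (<⇒≤ j<j₁)))

  trajectory-from-j₁ : ∀ {k} → j₁ ≤ k → trajectory k ≡ parked k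
  trajectory-from-j₁ j₁≤k = trans (splice-> (<-≤-trans j<j₁ j₁≤k)) (splice-≥ seam j₁≤k)
    where
    seam : conf ρ j₁ e₁ ≡ parked j₁
    seam = trans (reached A₁) (sym (splice-≤ j₁≤j₂))

  trajectory-parked : ∀ {k} → j₁ ≤ k → k ≤ j₂ → trajectory k ≡ q
  trajectory-parked j₁≤k k≤j₂ = trans (trajectory-from-j₁ j₁≤k) (splice-≤ k≤j₂)

  trajectory-after : ∀ {k} → j₂ ≤ k → trajectory k ≡ conf ρ k e₂
  trajectory-after j₂≤k =
    trans (trajectory-from-j₁ (≤-trans j₁≤j₂ j₂≤k)) (splice-≥ (sym (reached A₂)) j₂≤k)

  conf′ : ℕ → Config P n
  conf′ k = updateAt (conf ρ k) e₂ (const (trajectory k))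

  e₂-follows : ∀ k → conf′ k e₂ ≡ trajectory k
  e₂-follows k = updateAt-updates e₂ (conf ρ k)

  unchanged : ∀ {k} → trajectory k ≡ conf ρ k e₂ → conf′ k ≗ conf ρ k
  unchanged {k} = updateAt-id-local e₂ (conf ρ k)

  e₁-unchanged : ∀ k → k ≤ j₂ → conf′ k e₁ ≡ conf ρ k e₁
  e₁-unchanged k k≤j₂ with e₁ ≟ e₂
  ... | no e₁≢e₂ = updateAt-minimal e₁ e₂ (conf ρ k) e₁≢e₂
  ... | yes refl with ≤-total k j  -- e₁ = e₂ forces j₁ = j₂
  ...   | inj₁ k≤j = unchanged (trajectory-before k≤j) e₁
  ...   | inj₂ j≤k = trans (e₂-follows k) (trajectory-copies j≤k (≤-trans k≤j₂ j₂≤j₁))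
    where
    j₂≤j₁ : j₂ ≤ j₁
    j₂≤j₁ = FirstAction-minimal A₂ (start≤ A₁) (subst (QA P) (sym (reached A₁)) (action A₁))

  step-unchanged : ∀ {i} → trajectory i ≡ conf ρ i e₂ → trajectory (suc i) ≡ conf ρ (suc i) e₂ →
    _⟶_ P (conf ρ i) (conf ρ (suc i)) → _⟶_ P (conf′ i) (conf′ (suc i))
  step-unchanged before after =
    ⟶-resp-≗ {P = P} (λ e → sym (unchanged before e)) (λ e → sym (unchanged after e))

  step-between : ∀ {i} → j ≤ i → i < j₂ →
    _⟶_ P (conf ρ i) (conf ρ (suc i)) → _⟶_ P (conf′ i) (conf′ (suc i))
  step-between {i} j≤i i<j₂ (e , s , a , s′ , step@(_ , _ , _ , reacts)) =
    ⟶-updateAt {P = P} step e≢e₂ e₂-reacts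
    where
    e≢e₂ : e ≢ e₂
    e≢e₂ refl = waiting-cannot-broadcast wait-only step (waiting A₂ i j≤i i<j₂)

    e₂-reacts : Reacts P a (trajectory i) (trajectory (suc i))
    e₂-reacts with j₁ ≤? i
    ... | no j₁≰i =
      subst₂ (Reacts P a) (sym (trajectory-copies j≤i (<⇒≤ i<j₁)))
        (sym (trajectory-copies (m≤n⇒m≤1+n j≤i) i<j₁)) (reacts e₁ e₁≢e)
      where
      i<j₁ : i < j₁
      i<j₁ = ≰⇒> j₁≰i

      e₁≢e : e₁ ≢ e
      e₁≢e refl = waiting-cannot-broadcast wait-only step (waiting A₁ i j≤i i<j₁)
    ... | yes j₁≤i =
      subst₂ (Reacts P a) (sym (trajectory-parked j₁≤i (<⇒≤ i<j₂)))
        (sym (trajectory-parked (m≤n⇒m≤1+n j₁≤i) i<j₂)) (action-state-ignores {P = P} (action A₁))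

  step′ : ∀ i → suc i <ᴸ len ρ → _⟶_ P (conf′ i) (conf′ (suc i))
  step′ i i+1<len with j ≤? i | j₂ ≤? i
  ... | no j≰i | _ =
    step-unchanged (trajectory-before (<⇒≤ (≰⇒> j≰i))) (trajectory-before (≰⇒> j≰i))
      (steps ρ i i+1<len)
  ... | yes j≤i | no j₂≰i = step-between j≤i (≰⇒> j₂≰i) (steps ρ i i+1<len)
  ... | yes _ | yes j₂≤i =
    step-unchanged (trajectory-after j₂≤i) (trajectory-after (m≤n⇒m≤1+n j₂≤i)) (steps ρ i i+1<len)

  ρ′ : Execution P n
  ρ′ = record
    { len     = len ρ
    ; len-pos = len-pos ρ
    ; conf    = conf′
    ; initial = λ e → trans (unchanged (trajectory-before z≤n) e) (initial ρ e)
    ; steps   = step′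
    }

-- The bounds j <ᴸ len ρ and j₂ <ᴸ len ρ are implied by the Next hypotheses.
mainTheorem7 : (P : Protocol) → WaitOnly P →
    {n : ℕ} (ρ : Execution P n) (e₁ e₂ : Fin n) (j j₁ j₂ : ℕ) (q : State P) →
    j <ᴸ len ρ →
    conf ρ j e₁ ≡ conf ρ j e₂ → QW P (conf ρ j e₁) →
    Next ρ j e₁ (just q) (fin j₁) →
    Next ρ j e₂ (just q) (fin j₂) →
    j₁ ≤ j₂ → j₂ <ᴸ len ρ →
    Σ[ ρ′ ∈ Execution P n ]
      ( len ρ′ ≡ len ρ
      × (∀ k → k ≤ j → ∀ e → conf ρ′ k e ≡ conf ρ k e)
      × (∀ k → j₂ < k → k <ᴸ len ρ → ∀ e → conf ρ′ k e ≡ conf ρ k e)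
      × (∀ k → suc j ≤ k → k ≤ j₁ →
           conf ρ′ k e₁ ≡ conf ρ k e₁ × conf ρ′ k e₂ ≡ conf ρ k e₁)
      × (∀ k → j₁ < k → k ≤ j₂ →
           conf ρ′ k e₁ ≡ conf ρ k e₁ × conf ρ′ k e₂ ≡ q)
      × Next ρ′ j e₁ (just q) (fin j₁)
      × Next ρ′ j e₂ (just q) (fin j₁) )
mainTheorem7 P wait-only ρ e₁ e₂ j j₁ j₂ q _ same-at-j waiting-at-j next₁ next₂ j₁≤j₂ _ =
  ρ′ , refl ,
  (λ k k≤j → unchanged (trajectory-before k≤j)) ,
  (λ k j₂<k _ → unchanged (trajectory-after (<⇒≤ j₂<k))) ,
  (λ k j<k k≤j₁ → e₁-unchanged k (≤-trans k≤j₁ j₁≤j₂) , e₂-copies (<⇒≤ j<k) k≤j₁) ,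
  (λ k j₁<k k≤j₂ → e₁-unchanged k k≤j₂ , trans (e₂-follows k) (trajectory-parked (<⇒≤ j₁<k) k≤j₂)) ,
  Next-resp refl (λ m _ m≤j₁ → e₁-unchanged m (≤-trans m≤j₁ j₁≤j₂)) next₁ ,
  Next-resp refl (λ m j≤m m≤j₁ → e₂-copies j≤m m≤j₁) next₁
  where
  open Redirect P wait-only ρ e₁ e₂ j j₁ j₂ q same-at-j waiting-at-j
    (Next⇒FirstAction next₁) (Next⇒FirstAction next₂) j₁≤j₂

  e₂-copies : ∀ {k} → j ≤ k → k ≤ j₁ → conf ρ′ k e₂ ≡ conf ρ k e₁
  e₂-copies {k} j≤k k≤j₁ = trans (e₂-follows k) (trajectory-copies j≤k k≤j₁)
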